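{- For every $n\ge1$, $\mathsf{c}_{\wedge}(\mathrm{MAJ}_n)\ge n-\mathsf{B}(n)$.
   Context: $\mathrm{MAJ}_n\colon\{0,1\}^n\to\{ -1,1\}$ is defined by $\mathrm{MAJ}_n(x)=-1$ ("true") iff $\sum_{i=1}^n x_i\ge n/2$. $\mathsf{B}(n)$ is the number of ones in the binary representation of $n$. The multiplicative complexity $\mathsf{c}_{\wedge}(f)$ of a Boolean function $f$ is the minimal number of AND gates in a Boolean circuit computing $f$ built from AND, XOR ($\oplus$) and NOT gates, each of fan-in at most $2$. -}

module Defs where

open import Data.Nat using (ℕ; zero; suc; _+_; _*_; _≤ᵇ_; _/_; _%_)
open import Data.Bool using (Bool; true; false; not; _∧_; _xor_; if_then_else_)
open import Data.Fin using (Fin)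
open import Data.Vec using (Vec; []; _∷_; lookup)

ones : ∀ {n} → Vec Bool n → ℕ
ones []          = 0
ones (b ∷ bs)    = (if b then 1 else 0) + ones bs

-- MAJ_n(x) is "true" (the value -1 in the paper's ±1 convention) iff
-- Σ x_i ≥ n/2, i.e. n ≤ 2·Σ x_i.  We encode the output -1 as Bool true.
MAJ : (n : ℕ) → Vec Bool n → Bool
MAJ n x = n ≤ᵇ (2 * ones x)

-- B(n): number of ones in the binary representation of n.
-- Computed by repeated halving with fuel; fuel n suffices since n/2 < n.
popAux : ℕ → ℕ → ℕ
popAux zero     m = 0
popAux (suc f)  m = (m % 2) + popAux f (m / 2)

B : ℕ → ℕ
B n = popAux n n

data Gate (m : ℕ) : Set where
  AND : Fin m → Fin m → Gate m
  XOR : Fin m → Fin m → Gate m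
  NOT : Fin m → Gate m

-- Wires of a k-gate circuit are indexed by Fin (k + n): index 0 is the
-- most recently added gate, ..., the last n indices are the inputs.
data Circuit (n : ℕ) : ℕ → Set where
  inputs : Circuit n 0
  _▷_    : ∀ {k} → Circuit n k → Gate (k + n) → Circuit n (suc k)

evalGate : ∀ {m} → Gate m → Vec Bool m → Bool
evalGate (AND i j) v = lookup v i ∧ lookup v j
evalGate (XOR i j) v = lookup v i xor lookup v j
evalGate (NOT i)   v = not (lookup v i)

wires : ∀ {n k} → Circuit n k → Vec Bool n → Vec Bool (k + n)
wires inputs    x = x
wires (C ▷ g)   x = evalGate g (wires C x) ∷ wires C x

andCount : ∀ {n k} → Circuit n k → ℕ
andCount inputs          = 0
andCount (C ▷ AND _ _)   = suc (andCount C)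
andCount (C ▷ XOR _ _)   = andCount C
andCount (C ▷ NOT _)     = andCount C

Computes : ∀ {n k} → Circuit n k → Fin (k + n) → (Vec Bool n → Bool) → Set
Computes C o f = ∀ x → lookup (wires C x) o ≡ f x
  where open import Relation.Binary.PropositionalEquality using (_≡_)

McLowerBound : (n : ℕ) → (Vec Bool n → Bool) → ℕ → Set
McLowerBound n f r = ∀ {k} (C : Circuit n k) (o : Fin (k + n)) → Computes C o f → r Data.Nat.≤ andCount C

-- Write bias f = Σₓ (−1)^f(x).  If a circuit with k AND gates has output f, then
-- 2^k · bias (f ⊕ χ) is divisible by 2^n for every affine χ: splitting the cube along
-- the (affine) first input of an AND gate into two affine halves makes that gate affine
-- on each half, so after k halvings every wire is affine, and the bias of an affine
-- function on an m-cube is 0 or ±2^m.  For MAJ_(N+1) and χ = x₀ the bias is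
-- 2 · C(N, ⌊N/2⌋), whose 2-adic valuation is B(N+1) by Kummer's theorem
-- (via Legendre's formula v₂(m!) = m − B(m)).  So 2^n divides 2^k · 2^B(n) · (odd),
-- i.e. n ≤ k + B(n).
module Submission where

open import Defs
open import Data.Nat using (ℕ; _≤_; _∸_)

open import Algebra.Bundles using (CommutativeRing)
import Algebra.Properties.CommutativeSemigroup as CommSemigroupProperties
open import Data.Bool using (Bool; true; false; not; _∧_; _xor_; if_then_else_)
open import Data.Bool.Properties
  using (xor-identityʳ; xor-comm; not-distribʳ-xor; ∧-distribʳ-xor; xor-∧-commutativeRing)
open import Data.Fin using (Fin; zero; suc)
open import Data.Integer as ℤ using (ℤ; +_; -_; 0ℤ)
import Data.Integer.Properties as ℤ
open import Data.Integer.Divisibility.Signed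
  using (divides; ∣⇒∣ᵤ) renaming (_∣_ to _∣ℤ_)
import Data.Integer.Divisibility.Signed as ℤ∣
open import Data.Nat
  using (zero; suc; _+_; _*_; _^_; _<_; _<ᵇ_; _≤ᵇ_; _≡ᵇ_; _%_; _/_; ⌊_/2⌋; ⌈_/2⌉; _!; s≤s; z≤n)
open import Data.Nat.Properties
open import Data.Nat.Combinatorics using (_C_; nCk≡n!/k![n-k]!; k![n∸k]!∣n!; nCk+nC[k+1]≡[n+1]C[k+1])
open import Data.Nat.DivMod using (m/n<m; m*[n/m]≡n; m*n%n≡0; m*n/n≡m; [m+kn]%n≡m%n; +-distrib-/-∣ʳ)
open import Data.Nat.Divisibility
  using (_∣_; divides; module ∣-Reasoning; ∣-trans; m∣m*n; ∣m+n∣m⇒∣n; ∣1⇒≡1; *-cancelˡ-∣)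
  renaming (*-monoʳ-∣ to *-monoʳ-∣ℕ)
open import Data.Nat.Induction using (<-rec)
open import Data.Nat.Primality using (prime[2]; euclidsLemma)
open import Data.Bool.Solver using (module xor-∧-Solver)
import Data.Nat.Tactic.RingSolver as ℕ-Solver
import Data.Integer.Tactic.RingSolver as ℤ-Solver
open import Data.Product using (Σ-syntax; ∃; ∃₂; _×_; _,_; proj₁; proj₂)
open import Data.Sum using (_⊎_; inj₁; inj₂; [_,_]′)
open import Data.Vec using (Vec; []; _∷_; lookup; replicate; zipWith; insertAt; removeAt)
open import Function using (_∘_)
open import Relation.Nullary using (¬_; contradiction)
open import Relation.Nullary.Reflects using (det; fromEquivalence)
open import Relation.Binary.PropositionalEquality

open CommSemigroupProperties (CommutativeRing.+-commutativeSemigroup xor-∧-commutativeRing)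
  using () renaming (interchange to xor-interchange; x∙yz≈y∙xz to xor-leftSwap)
open CommSemigroupProperties ℤ.+-commutativeSemigroup
  using () renaming (interchange to +-interchange)

sumCube : (d : ℕ) → (Vec Bool d → ℤ) → ℤ
sumCube zero    F = F []
sumCube (suc d) F = sumCube d (λ y → F (false ∷ y)) ℤ.+ sumCube d (λ y → F (true ∷ y))

sumCube-cong : ∀ d {F G : Vec Bool d → ℤ} → (∀ y → F y ≡ G y) → sumCube d F ≡ sumCube d G
sumCube-cong zero    F≗G = F≗G []
sumCube-cong (suc d) F≗G =
  cong₂ ℤ._+_ (sumCube-cong d (F≗G ∘ (false ∷_))) (sumCube-cong d (F≗G ∘ (true ∷_)))

sumCube-+ : ∀ d (F G : Vec Bool d → ℤ) →
            sumCube d (λ y → F y ℤ.+ G y) ≡ sumCube d F ℤ.+ sumCube d G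
sumCube-+ zero    F G = refl
sumCube-+ (suc d) F G =
  trans (cong₂ ℤ._+_ (sumCube-+ d _ _) (sumCube-+ d _ _))
        (+-interchange (face F false) (face G false) (face F true) (face G true))
  where face = λ (H : Vec Bool (suc d) → ℤ) b → sumCube d (λ y → H (b ∷ y))

sumCube-neg : ∀ d (F : Vec Bool d → ℤ) → sumCube d (λ y → - F y) ≡ - sumCube d F
sumCube-neg zero    F = refl
sumCube-neg (suc d) F =
  trans (cong₂ ℤ._+_ (sumCube-neg d _) (sumCube-neg d _))
        (sym (ℤ.neg-distrib-+ (sumCube d (λ y → F (false ∷ y))) (sumCube d (λ y → F (true ∷ y)))))

sumCube-zero : ∀ d → sumCube d (λ _ → 0ℤ) ≡ 0ℤ
sumCube-zero zero    = refl
sumCube-zero (suc d) = cong₂ ℤ._+_ (sumCube-zero d) (sumCube-zero d)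

sumCube-insertAt : ∀ d (j : Fin (suc d)) (F : Vec Bool (suc d) → ℤ) →
  sumCube (suc d) F ≡ sumCube d (λ y → F (insertAt y j false) ℤ.+ F (insertAt y j true))
sumCube-insertAt d       zero    F = sym (sumCube-+ d _ _)
sumCube-insertAt (suc d) (suc j) F =
  cong₂ ℤ._+_ (sumCube-insertAt d j (λ y → F (false ∷ y)))
              (sumCube-insertAt d j (λ y → F (true ∷ y)))

sgn : Bool → ℤ
sgn false = + 1
sgn true  = - + 1

sgn-not : ∀ b → sgn (not b) ≡ - sgn b
sgn-not false = refl
sgn-not true  = refl

bias : (d : ℕ) → (Vec Bool d → Bool) → ℤ
bias d g = sumCube d (sgn ∘ g)

pow2-∣-double : ∀ d {x} → + (2 ^ d) ∣ℤ x → + (2 ^ suc d) ∣ℤ x ℤ.+ x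
pow2-∣-double d {x} (divides q x≡q2ᵈ) = divides q (begin
  x ℤ.+ x                          ≡⟨ cong₂ ℤ._+_ x≡q2ᵈ x≡q2ᵈ ⟩
  q ℤ.* + (2 ^ d) ℤ.+ q ℤ.* + (2 ^ d) ≡⟨ double-* q (+ (2 ^ d)) ⟩
  q ℤ.* (+ 2 ℤ.* + (2 ^ d))        ≡⟨ cong (q ℤ.*_) (sym (ℤ.pos-* 2 (2 ^ d))) ⟩
  q ℤ.* + (2 ^ suc d)              ∎)
  where
  open ≡-Reasoning
  double-* : ∀ q t → q ℤ.* t ℤ.+ q ℤ.* t ≡ q ℤ.* (+ 2 ℤ.* t)
  double-* = ℤ-Solver.solve-∀

-- Affine Boolean functions

dot : ∀ {d} → Vec Bool d → Vec Bool d → Bool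
dot []       []       = false
dot (a ∷ as) (y ∷ ys) = (a ∧ y) xor dot as ys

IsAffine : (d : ℕ) → (Vec Bool d → Bool) → Set
IsAffine d g = Σ[ c ∈ Bool ] Σ[ a ∈ Vec Bool d ] (∀ y → g y ≡ c xor dot a y)

dot-zeroˡ : ∀ {d} (y : Vec Bool d) → dot (replicate d false) y ≡ false
dot-zeroˡ []       = refl
dot-zeroˡ (y ∷ ys) = dot-zeroˡ ys

dot-xorˡ : ∀ {d} (a a′ y : Vec Bool d) → dot (zipWith _xor_ a a′) y ≡ dot a y xor dot a′ y
dot-xorˡ []       []         []       = refl
dot-xorˡ (a ∷ as) (a′ ∷ as′) (y ∷ ys) =
  trans (cong₂ _xor_ (∧-distribʳ-xor y a a′) (dot-xorˡ as as′ ys))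
        (xor-interchange (a ∧ y) (a′ ∧ y) (dot as ys) (dot as′ ys))

dot-insertAt : ∀ {d} (a : Vec Bool (suc d)) (y : Vec Bool d) (j : Fin (suc d)) t →
               dot a (insertAt y j t) ≡ (lookup a j ∧ t) xor dot (removeAt a j) y
dot-insertAt (a ∷ as)       y        zero    t = refl
dot-insertAt (a ∷ a′ ∷ as) (y ∷ ys) (suc j) t =
  trans (cong ((a ∧ y) xor_) (dot-insertAt (a′ ∷ as) ys j t))
        (xor-leftSwap (a ∧ y) (lookup (a′ ∷ as) j ∧ t) (dot (removeAt (a′ ∷ as) j) ys))

affine-cong : ∀ {d} {g h : Vec Bool d → Bool} → IsAffine d g → (∀ y → h y ≡ g y) → IsAffine d h
affine-cong (c , a , g≡) h≡g = c , a , λ y → trans (h≡g y) (g≡ y)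

affine-const : ∀ {d} b → IsAffine d (λ _ → b)
affine-const {d} b = b , replicate d false , λ y →
  sym (trans (cong (b xor_) (dot-zeroˡ y)) (xor-identityʳ b))

dot-affine : ∀ {d} (a : Vec Bool d) → IsAffine d (dot a)
dot-affine a = false , a , λ _ → refl

affine-xor : ∀ {d} {g h : Vec Bool d → Bool} →
             IsAffine d g → IsAffine d h → IsAffine d (λ y → g y xor h y)
affine-xor (c , a , g≡) (c′ , a′ , h≡) = c xor c′ , zipWith _xor_ a a′ , λ y →
  trans (cong₂ _xor_ (g≡ y) (h≡ y))
        (trans (xor-interchange c _ c′ _) (cong ((c xor c′) xor_) (sym (dot-xorˡ a a′ y))))

const-∧-affine : ∀ {d} {g : Vec Bool d → Bool} c → IsAffine d g → IsAffine d (λ y → c ∧ g y)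
const-∧-affine false _ = affine-const false
const-∧-affine true  G = G

lookup-affine : ∀ {d} (i : Fin d) → IsAffine d (λ y → lookup y i)
lookup-affine {suc d} zero = false , true ∷ replicate d false , λ where
  (y ∷ ys) → sym (trans (cong (y xor_) (dot-zeroˡ ys)) (xor-identityʳ y))
lookup-affine (suc i) with lookup-affine i
... | c , a , e = c , false ∷ a , λ where (y ∷ ys) → e ys

bias-affine : ∀ d {g} → IsAffine d g → + (2 ^ d) ∣ℤ bias d g
bias-affine zero    {g} _ = divides (bias 0 g) (sym (ℤ.*-identityʳ _))
bias-affine (suc d) {g} (c , false ∷ a , g≡) =
  subst (_ ∣ℤ_) (sym (cong₂ ℤ._+_ (restrict false) (restrict true)))
        (pow2-∣-double d (bias-affine d (c , a , λ _ → refl)))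
  where
  restrict : ∀ b → bias d (λ y → g (b ∷ y)) ≡ bias d (λ y → c xor dot a y)
  restrict b = sumCube-cong d (λ y → cong sgn (g≡ (b ∷ y)))
bias-affine (suc d) {g} (c , true ∷ a , g≡) = divides 0ℤ (begin
  bias d (λ y → g (false ∷ y)) ℤ.+ bias d (λ y → g (true ∷ y))
    ≡⟨ cong₂ ℤ._+_ (sumCube-cong d (λ y → cong sgn (g≡ (false ∷ y))))
                   (sumCube-cong d (λ y → trans (cong sgn (trans (g≡ (true ∷ y))
                                                              (sym (not-distribʳ-xor c _))))
                                                (sgn-not (c xor dot a y)))) ⟩
  f ℤ.+ sumCube d (λ y → - sgn (c xor dot a y))
    ≡⟨ cong (λ s → f ℤ.+ s) (sumCube-neg d _) ⟩
  f ℤ.+ - f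
    ≡⟨ ℤ.+-inverseʳ f ⟩
  0ℤ ∎)
  where
  open ≡-Reasoning
  f = bias d (λ y → c xor dot a y)

record Halving (d : ℕ) : Set where
  field
    half        : Bool → Vec Bool d → Vec Bool (suc d)
    bias-halves : ∀ g → bias (suc d) g ≡ bias d (g ∘ half false) ℤ.+ bias d (g ∘ half true)
    half-affine : ∀ b {g} → IsAffine (suc d) g → IsAffine d (g ∘ half b)

open Halving

insertion-halving : ∀ {d} (j : Fin (suc d)) (t : Vec Bool d → Bool) → IsAffine d t → Halving d
insertion-halving {d} j t T = record
  { half        = λ b y → insertAt y j (b xor t y)
  ; bias-halves = λ g → trans (sumCube-insertAt d j (sgn ∘ g))
                              (trans (sumCube-cong d (λ y → swap (sgn ∘ g ∘ insertAt y j) (t y)))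
                                     (sumCube-+ d _ _))
  ; half-affine = λ b {g} → λ where
      (c , a , g≡) → affine-cong
        (affine-xor (affine-const c)
          (affine-xor (const-∧-affine (lookup a j) (affine-xor (affine-const b) T))
                      (dot-affine (removeAt a j))))
        (λ y → trans (g≡ _) (cong (c xor_) (dot-insertAt a y j (b xor t y))))
  }
  where
  swap : ∀ (F : Bool → ℤ) s → F false ℤ.+ F true ≡ F s ℤ.+ F (not s)
  swap F false = refl
  swap F true  = ℤ.+-comm (F false) (F true)

-- Solves c ⊕ a·x = b for the coordinate xⱼ, which is possible when aⱼ = true.
halving-along : ∀ {d} (c : Bool) (a : Vec Bool (suc d)) (j : Fin (suc d)) → Halving d
halving-along c a j =
  insertion-halving j (λ y → c xor dot (removeAt a j) y) (c , removeAt a j , λ _ → refl)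

halving-along-levels : ∀ {d} c (a : Vec Bool (suc d)) j → lookup a j ≡ true →
                       ∀ b y → c xor dot a (half (halving-along c a j) b y) ≡ b
halving-along-levels c a j aⱼ b y =
  trans (cong (c xor_) (dot-insertAt a y j _))
        (subst (λ aⱼ′ → c xor ((aⱼ′ ∧ (b xor (c xor D))) xor D) ≡ b) (sym aⱼ) (cancel b c D))
  where
  D = dot (removeAt a j) y
  cancel : ∀ b c D → c xor ((b xor (c xor D)) xor D) ≡ b
  cancel = solve 3 (λ b c D → c :+ ((b :+ (c :+ D)) :+ D) := b) refl
    where open xor-∧-Solver

pivot-or-zero : ∀ {d} (a : Vec Bool d) → (∃ λ j → lookup a j ≡ true) ⊎ (∀ y → dot a y ≡ false)
pivot-or-zero []           = inj₂ λ where [] → refl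
pivot-or-zero (true  ∷ as) = inj₁ (zero , refl)
pivot-or-zero (false ∷ as) with pivot-or-zero as
... | inj₁ (j , aⱼ) = inj₁ (suc j , aⱼ)
... | inj₂ as≡0     = inj₂ λ where (y ∷ ys) → as≡0 ys

-- Wires of a circuit are piecewise affine

AllAffine : ∀ {d m} → (Vec Bool d → Vec Bool m) → Set
AllAffine {d} W = ∀ i → IsAffine d (λ y → lookup (W y) i)

-- k bounds the number of successive halvings needed to make every wire affine.
data PiecewiseAffine {m : ℕ} : ℕ → (d : ℕ) → (Vec Bool d → Vec Bool m) → Set where
  affine : ∀ {k d W} → AllAffine W → PiecewiseAffine k d W
  split  : ∀ {k d W} (H : Halving d) → (∀ b → PiecewiseAffine k d (W ∘ half H b)) →
           PiecewiseAffine (suc k) (suc d) W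

extendWires : ∀ {d m} → Gate m → (Vec Bool d → Vec Bool m) → Vec Bool d → Vec Bool (suc m)
extendWires g W y = evalGate g (W y) ∷ W y

PreservesAffine : ∀ {m} → Gate m → Set
PreservesAffine {m} g =
  ∀ {d} (W : Vec Bool d → Vec Bool m) → AllAffine W → IsAffine d (λ y → evalGate g (W y))

xor-preservesAffine : ∀ {m} (i j : Fin m) → PreservesAffine (XOR i j)
xor-preservesAffine i j W A = affine-xor (A i) (A j)

not-preservesAffine : ∀ {m} (i : Fin m) → PreservesAffine (NOT i)
not-preservesAffine i W A = affine-xor (affine-const true) (A i)

extend-piecewiseAffine : ∀ {m k d} {W : Vec Bool d → Vec Bool m} (g : Gate m) → PreservesAffine g →
                         PiecewiseAffine k d W → PiecewiseAffine k d (extendWires g W)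
extend-piecewiseAffine {W = W} g g-aff (affine A) = affine λ where
  zero    → g-aff W A
  (suc i) → A i
extend-piecewiseAffine g g-aff (split H P) = split H (λ b → extend-piecewiseAffine g g-aff (P b))

-- On each half of the halving along its first input, an AND gate is a constant times its
-- second input.
extend-affine-AND : ∀ {m k d} {W : Vec Bool d → Vec Bool m} i j → AllAffine W →
                    PiecewiseAffine (suc k) d (extendWires (AND i j) W)
extend-affine-AND {W = W} i j A with A i
... | c , a , Wᵢ≡ with pivot-or-zero a
... | inj₂ a≡0 = affine λ where
  zero    → affine-cong (const-∧-affine c (A j))
              (λ y → cong (_∧ lookup (W y) j)
                          (trans (Wᵢ≡ y) (trans (cong (c xor_) (a≡0 y)) (xor-identityʳ c))))
  (suc r) → A r
extend-affine-AND {d = suc d} {W = W} i j A | c , a , Wᵢ≡ | inj₁ (p , aₚ) =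
  split H λ b → affine λ where
    zero    → affine-cong (const-∧-affine b (half-affine H b (A j)))
                (λ y → cong (_∧ lookup (W (half H b y)) j)
                            (trans (Wᵢ≡ _) (halving-along-levels c a p aₚ b y)))
    (suc r) → half-affine H b (A r)
  where H = halving-along c a p

extend-piecewiseAffine-AND : ∀ {m k d} {W : Vec Bool d → Vec Bool m} i j →
  PiecewiseAffine k d W → PiecewiseAffine (suc k) d (extendWires (AND i j) W)
extend-piecewiseAffine-AND i j (affine A)  = extend-affine-AND i j A
extend-piecewiseAffine-AND i j (split H P) = split H (λ b → extend-piecewiseAffine-AND i j (P b))

wires-piecewiseAffine : ∀ {n k} (circ : Circuit n k) → PiecewiseAffine (andCount circ) n (wires circ)
wires-piecewiseAffine inputs           = affine lookup-affine
wires-piecewiseAffine (circ ▷ AND i j) = extend-piecewiseAffine-AND i j (wires-piecewiseAffine circ)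
wires-piecewiseAffine (circ ▷ XOR i j) =
  extend-piecewiseAffine (XOR i j) (xor-preservesAffine i j) (wires-piecewiseAffine circ)
wires-piecewiseAffine (circ ▷ NOT i)   =
  extend-piecewiseAffine (NOT i) (not-preservesAffine i) (wires-piecewiseAffine circ)

piecewiseAffine-granular : ∀ {m k d} {W : Vec Bool d → Vec Bool m} → PiecewiseAffine k d W →
  ∀ i {χ} → IsAffine d χ → + (2 ^ d) ∣ℤ + (2 ^ k) ℤ.* bias d (λ y → lookup (W y) i xor χ y)
piecewiseAffine-granular {k = k} {d} (affine A) i X =
  ℤ∣.∣n⇒∣m*n (+ (2 ^ k)) (bias-affine d (affine-xor (A i) X))
piecewiseAffine-granular {k = suc k} {suc d} {W} (split H P) i {χ} X =
  subst (_ ∣ℤ_) (sym (begin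
    + (2 ^ suc k) ℤ.* bias (suc d) f
      ≡⟨ cong₂ ℤ._*_ (ℤ.pos-* 2 (2 ^ k)) (bias-halves H f) ⟩
    (+ 2 ℤ.* + (2 ^ k)) ℤ.* (bias d (f ∘ half H false) ℤ.+ bias d (f ∘ half H true))
      ≡⟨ distrib (+ (2 ^ k)) _ _ ⟩
    x ℤ.+ x ∎))
    (pow2-∣-double d (ℤ∣.∣m∣n⇒∣m+n (halfGranular false) (halfGranular true)))
  where
  open ≡-Reasoning
  f = λ y → lookup (W y) i xor χ y
  x = + (2 ^ k) ℤ.* bias d (f ∘ half H false) ℤ.+ + (2 ^ k) ℤ.* bias d (f ∘ half H true)
  halfGranular : ∀ b → + (2 ^ d) ∣ℤ + (2 ^ k) ℤ.* bias d (f ∘ half H b)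
  halfGranular b = piecewiseAffine-granular (P b) i (half-affine H b X)
  distrib : ∀ p u v → (+ 2 ℤ.* p) ℤ.* (u ℤ.+ v) ≡ (p ℤ.* u ℤ.+ p ℤ.* v) ℤ.+ (p ℤ.* u ℤ.+ p ℤ.* v)
  distrib = ℤ-Solver.solve-∀

-- The bias of MAJ ⊕ x₀

sumCube-ones : ∀ N h (z : ℤ) → sumCube N (λ y → if ones y ≡ᵇ h then z else 0ℤ) ≡ + (N C h) ℤ.* z
sumCube-ones zero    zero    z = sym (ℤ.*-identityˡ z)
sumCube-ones zero    (suc h) z = refl
sumCube-ones (suc N) zero    z =
  trans (cong₂ ℤ._+_ (sumCube-ones N zero z) (sumCube-zero N)) (ℤ.+-identityʳ _)
sumCube-ones (suc N) (suc h) z = begin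
  sumCube N (λ y → if ones y ≡ᵇ suc h then z else 0ℤ) ℤ.+
  sumCube N (λ y → if ones y ≡ᵇ h then z else 0ℤ)
    ≡⟨ cong₂ ℤ._+_ (sumCube-ones N (suc h) z) (sumCube-ones N h z) ⟩
  + (N C suc h) ℤ.* z ℤ.+ + (N C h) ℤ.* z
    ≡⟨ sym (ℤ.*-distribʳ-+ z (+ (N C suc h)) (+ (N C h))) ⟩
  (+ (N C suc h) ℤ.+ + (N C h)) ℤ.* z
    ≡⟨ cong (ℤ._* z) (sym (ℤ.pos-+ (N C suc h) (N C h))) ⟩
  + (N C suc h + N C h) ℤ.* z
    ≡⟨ cong (λ c → + c ℤ.* z)
            (trans (+-comm (N C suc h) (N C h)) (nCk+nC[k+1]≡[n+1]C[k+1] N h)) ⟩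
  + (suc N C suc h) ℤ.* z ∎
  where open ≡-Reasoning

⌊n/2⌋-bounds : ∀ N → 2 * ⌊ N /2⌋ ≤ N × N ≤ suc (2 * ⌊ N /2⌋)
⌊n/2⌋-bounds zero          = z≤n , z≤n
⌊n/2⌋-bounds (suc zero)    = z≤n , s≤s z≤n
⌊n/2⌋-bounds (suc (suc N)) with ⌊n/2⌋-bounds N
... | lower , upper rewrite *-suc 2 ⌊ N /2⌋ = s≤s (s≤s lower) , s≤s (s≤s upper)

majority-threshold : ∀ N w → (suc N ≤ᵇ 2 * w) ≡ (⌊ N /2⌋ <ᵇ w)
majority-threshold N w =
  det (≤ᵇ-reflects-≤ (suc N) (2 * w)) (fromEquivalence (from ∘ <ᵇ⇒< ⌊ N /2⌋ w) (<⇒<ᵇ ∘ to))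
  where
  lower = proj₁ (⌊n/2⌋-bounds N)
  upper = proj₂ (⌊n/2⌋-bounds N)
  from : ⌊ N /2⌋ < w → suc N ≤ 2 * w
  from h<w = ≤-trans (s≤s upper) (subst (_≤ 2 * w) (*-suc 2 ⌊ N /2⌋) (*-monoʳ-≤ 2 h<w))
  to : suc N ≤ 2 * w → ⌊ N /2⌋ < w
  to 1+N≤2w = ≰⇒> λ w≤h → 1+n≰n (≤-trans 1+N≤2w (≤-trans (*-monoʳ-≤ 2 w≤h) lower))

threshold-jump : ∀ h w → sgn (h <ᵇ w) ℤ.- sgn (h <ᵇ suc w) ≡ (if w ≡ᵇ h then + 2 else 0ℤ)
threshold-jump zero    zero    = refl
threshold-jump zero    (suc w) = refl
threshold-jump (suc h) zero    = refl
threshold-jump (suc h) (suc w) = threshold-jump h w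

majority-xor-head : ∀ N y →
  sgn (MAJ (suc N) (false ∷ y) xor false) ℤ.+ sgn (MAJ (suc N) (true ∷ y) xor true)
    ≡ (if ones y ≡ᵇ ⌊ N /2⌋ then + 2 else 0ℤ)
majority-xor-head N y = begin
  sgn (M₀ xor false) ℤ.+ sgn (M₁ xor true)
    ≡⟨ cong₂ (λ p q → sgn p ℤ.+ sgn q) (xor-identityʳ M₀) (xor-comm M₁ true) ⟩
  sgn M₀ ℤ.+ sgn (not M₁)
    ≡⟨ cong (λ s → sgn M₀ ℤ.+ s) (sgn-not M₁) ⟩
  sgn M₀ ℤ.- sgn M₁
    ≡⟨ cong₂ (λ p q → sgn p ℤ.- sgn q)
             (majority-threshold N (ones y)) (majority-threshold N (suc (ones y))) ⟩
  sgn (⌊ N /2⌋ <ᵇ ones y) ℤ.- sgn (⌊ N /2⌋ <ᵇ suc (ones y))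
    ≡⟨ threshold-jump ⌊ N /2⌋ (ones y) ⟩
  (if ones y ≡ᵇ ⌊ N /2⌋ then + 2 else 0ℤ) ∎
  where
  open ≡-Reasoning
  M₀ = suc N ≤ᵇ 2 * ones y
  M₁ = suc N ≤ᵇ 2 * suc (ones y)

bias-majority-xor-head : ∀ N →
  bias (suc N) (λ x → MAJ (suc N) x xor lookup x zero) ≡ + (N C ⌊ N /2⌋) ℤ.* + 2
bias-majority-xor-head N =
  trans (sym (sumCube-+ N _ _))
        (trans (sumCube-cong N (majority-xor-head N)) (sumCube-ones N ⌊ N /2⌋ (+ 2)))

-- Binary digit sums and 2-adic valuations

popAux-zero : ∀ f → popAux f 0 ≡ 0
popAux-zero zero    = refl
popAux-zero (suc f) = popAux-zero f

[1+m]/2≤m : ∀ m → suc m / 2 ≤ m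
[1+m]/2≤m m = ≤-pred (m/n<m (suc m) 2 ≤-refl)

popAux-fuel : ∀ {f g} m → m ≤ f → m ≤ g → popAux f m ≡ popAux g m
popAux-fuel {f} {g} zero _ _ = trans (popAux-zero f) (sym (popAux-zero g))
popAux-fuel {suc f} {suc g} (suc m) (s≤s m≤f) (s≤s m≤g) =
  cong (λ s → suc m % 2 + s)
       (popAux-fuel (suc m / 2) (≤-trans ([1+m]/2≤m m) m≤f) (≤-trans ([1+m]/2≤m m) m≤g))

B-suc : ∀ m → B (suc m) ≡ suc m % 2 + B (suc m / 2)
B-suc m = cong (λ s → suc m % 2 + s) (popAux-fuel (suc m / 2) ([1+m]/2≤m m) ≤-refl)

n+n≡n*2 : ∀ h → h + h ≡ h * 2
n+n≡n*2 h = sym (trans (*-comm h 2) (cong (λ s → h + s) (+-identityʳ h)))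

halve-even : ∀ h → (h + h) % 2 ≡ 0 × (h + h) / 2 ≡ h
halve-even h = subst (λ x → x % 2 ≡ 0 × x / 2 ≡ h) (sym (n+n≡n*2 h)) (m*n%n≡0 h 2 , m*n/n≡m h 2)

halve-odd : ∀ h → suc (h + h) % 2 ≡ 1 × suc (h + h) / 2 ≡ h
halve-odd h = subst (λ x → x % 2 ≡ 1 × x / 2 ≡ h) (cong suc (sym (n+n≡n*2 h)))
  ([m+kn]%n≡m%n 1 h 2 , trans (+-distrib-/-∣ʳ 1 {h * 2} {2} (divides h refl)) (m*n/n≡m h 2))

B-double : ∀ h → B (h + h) ≡ B h
B-double zero    = refl
B-double (suc h) with halve-even (suc h)
... | rem≡ , quot≡ = trans (B-suc (h + suc h)) (cong₂ (λ r q → r + B q) rem≡ quot≡)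

B-suc-double : ∀ h → B (suc (h + h)) ≡ suc (B h)
B-suc-double h with halve-odd h
... | rem≡ , quot≡ = trans (B-suc (h + h)) (cong₂ (λ r q → r + B q) rem≡ quot≡)

data Parity : ℕ → Set where
  even : ∀ h → Parity (h + h)
  odd  : ∀ h → Parity (suc (h + h))

parity : ∀ m → Parity m
parity zero = even 0
parity (suc m) with parity m
... | even h = odd h
... | odd h  = subst Parity (cong suc (+-suc h h)) (even (suc h))

B-halves : ∀ N → suc (B ⌊ N /2⌋ + B ⌈ N /2⌉) ≡ B (suc N) + B N
B-halves N with parity N
... | even h = begin
  suc (B ⌊ h + h /2⌋ + B ⌈ h + h /2⌉)
    ≡⟨ cong₂ (λ x y → suc (B x + B y)) (sym (n≡⌊n+n/2⌋ h)) (sym (n≡⌈n+n/2⌉ h)) ⟩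
  suc (B h) + B h
    ≡⟨ cong₂ _+_ (sym (B-suc-double h)) (sym (B-double h)) ⟩
  B (suc (h + h)) + B (h + h) ∎
  where open ≡-Reasoning
... | odd h = begin
  suc (B ⌈ h + h /2⌉ + B (suc ⌊ h + h /2⌋))
    ≡⟨ cong₂ (λ x y → suc (B x + B y)) (sym (n≡⌈n+n/2⌉ h)) (cong suc (sym (n≡⌊n+n/2⌋ h))) ⟩
  suc (B h + B (suc h))
    ≡⟨ cong suc (+-comm (B h) (B (suc h))) ⟩
  suc (B (suc h) + B h)
    ≡⟨ sym (+-suc (B (suc h)) (B h)) ⟩
  B (suc h) + suc (B h)
    ≡⟨ cong₂ _+_ (sym (B-double (suc h))) (sym (B-suc-double h)) ⟩
  B (suc h + suc h) + B (suc (h + h))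
    ≡⟨ cong (λ x → B (suc x) + B (suc (h + h))) (+-suc h h) ⟩
  B (suc (suc (h + h))) + B (suc (h + h)) ∎
  where open ≡-Reasoning

Odd : ℕ → Set
Odd q = ¬ 2 ∣ q

odd-* : ∀ {p q} → Odd p → Odd q → Odd (p * q)
odd-* {p} {q} odd-p odd-q 2∣pq = [ odd-p , odd-q ]′ (euclidsLemma p q prime[2] 2∣pq)

odd-suc-double : ∀ h → Odd (suc (h + h))
odd-suc-double h 2∣1+2h =
  contradiction (∣1⇒≡1 (∣m+n∣m⇒∣n (subst (2 ∣_) (+-comm 1 (h + h)) 2∣1+2h) (divides h (n+n≡n*2 h))))
                λ ()

suc-2-adic : ∀ m → ∃₂ λ v r → Odd r × suc m ≡ 2 ^ v * r × B (suc m) + v ≡ suc (B m)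
suc-2-adic = <-rec P go
  where
  P : ℕ → Set
  P m = ∃₂ λ v r → Odd r × suc m ≡ 2 ^ v * r × B (suc m) + v ≡ suc (B m)
  go : ∀ m → (∀ {m′} → m′ < m → P m′) → P m
  go m rec with parity m
  ... | even h = 0 , suc (h + h) , odd-suc-double h , sym (*-identityˡ _) ,
                 trans (+-identityʳ _) (trans (B-suc-double h) (cong suc (sym (B-double h))))
  ... | odd h with rec (s≤s (m≤m+n h h))
  ...   | v , r , odd-r , 1+h≡ , B≡ = suc v , r , odd-r , power≡ , digits≡
    where
    open ≡-Reasoning
    2+2h≡ : suc (suc (h + h)) ≡ suc h + suc h
    2+2h≡ = cong suc (sym (+-suc h h))
    power≡ : suc (suc (h + h)) ≡ 2 ^ suc v * r
    power≡ = begin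
      suc (suc (h + h))     ≡⟨ 2+2h≡ ⟩
      suc h + suc h         ≡⟨ cong (λ x → x + x) 1+h≡ ⟩
      2 ^ v * r + 2 ^ v * r ≡⟨ double (2 ^ v) r ⟩
      2 * 2 ^ v * r         ∎
      where
      double : ∀ x r → x * r + x * r ≡ 2 * x * r
      double = ℕ-Solver.solve-∀
    digits≡ : B (suc (suc (h + h))) + suc v ≡ suc (B (suc (h + h)))
    digits≡ = begin
      B (suc (suc (h + h))) + suc v ≡⟨ cong (λ x → B x + suc v) 2+2h≡ ⟩
      B (suc h + suc h) + suc v     ≡⟨ cong (_+ suc v) (B-double (suc h)) ⟩
      B (suc h) + suc v             ≡⟨ +-suc (B (suc h)) v ⟩
      suc (B (suc h) + v)           ≡⟨ cong suc B≡ ⟩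
      suc (suc (B h))               ≡⟨ cong suc (sym (B-suc-double h)) ⟩
      suc (B (suc (h + h)))         ∎

factorial-2-adic : ∀ m → ∃ λ q → Odd q × 2 ^ B m * m ! ≡ 2 ^ m * q
factorial-2-adic zero = 1 , odd-suc-double 0 , refl
factorial-2-adic (suc m) with factorial-2-adic m | suc-2-adic m
... | q , odd-q , m!≡ | v , r , odd-r , 1+m≡ , B≡ = r * q , odd-* odd-r odd-q , (begin
  2 ^ B (suc m) * (suc m * m !)        ≡⟨ cong (λ x → 2 ^ B (suc m) * (x * m !)) 1+m≡ ⟩
  2 ^ B (suc m) * (2 ^ v * r * m !)    ≡⟨ reassoc (2 ^ B (suc m)) (2 ^ v) r (m !) ⟩
  2 ^ B (suc m) * 2 ^ v * r * m !      ≡⟨ cong (λ x → x * r * m !) (^-distribˡ-+-* 2 (B (suc m)) v) ⟨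
  2 ^ (B (suc m) + v) * r * m !        ≡⟨ cong (λ x → 2 ^ x * r * m !) B≡ ⟩
  2 * 2 ^ B m * r * m !                ≡⟨ pull (2 ^ B m) r (m !) ⟩
  2 * r * (2 ^ B m * m !)              ≡⟨ cong (2 * r *_) m!≡ ⟩
  2 * r * (2 ^ m * q)                  ≡⟨ push (2 ^ m) r q ⟩
  2 * 2 ^ m * (r * q)                  ∎)
  where
  open ≡-Reasoning
  reassoc : ∀ a b c e → a * (b * c * e) ≡ a * b * c * e
  reassoc = ℕ-Solver.solve-∀
  pull : ∀ a r f → 2 * a * r * f ≡ 2 * r * (a * f)
  pull = ℕ-Solver.solve-∀
  push : ∀ a r q → 2 * r * (a * q) ≡ 2 * a * (r * q)
  push = ℕ-Solver.solve-∀

binomial-factorials : ∀ a b → ((a + b) C a) * (a ! * b !) ≡ (a + b) !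
binomial-factorials a b =
  subst (λ x → ((a + b) C a) * (a ! * x !) ≡ (a + b) !) (m+n∸m≡n a b) general
  where
  a≤a+b = m≤m+n a b
  general : ((a + b) C a) * (a ! * (a + b ∸ a) !) ≡ (a + b) !
  general = begin
    ((a + b) C a) * (a ! * (a + b ∸ a) !)
      ≡⟨ cong (_* (a ! * (a + b ∸ a) !)) (nCk≡n!/k![n-k]! a≤a+b) ⟩
    ((a + b) ! / (a ! * (a + b ∸ a) !)) {{a !* (a + b ∸ a) !≢0}} * (a ! * (a + b ∸ a) !)
      ≡⟨ *-comm _ (a ! * (a + b ∸ a) !) ⟩
    (a ! * (a + b ∸ a) !) * ((a + b) ! / (a ! * (a + b ∸ a) !)) {{a !* (a + b ∸ a) !≢0}}
      ≡⟨ m*[n/m]≡n {{a !* (a + b ∸ a) !≢0}} (k![n∸k]!∣n! a≤a+b) ⟩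
    (a + b) ! ∎
    where open ≡-Reasoning

binomial-2-adic : ∀ a b → ∃₂ λ p q → Odd p × Odd q ×
                  2 ^ B (a + b) * ((a + b) C a) * p ≡ 2 ^ (B a + B b) * q
binomial-2-adic a b with factorial-2-adic a | factorial-2-adic b | factorial-2-adic (a + b)
... | qa , odd-qa , a!≡ | qb , odd-qb , b!≡ | q , odd-q , [a+b]!≡ =
  qa * qb , q , odd-* odd-qa odd-qb , odd-q ,
  *-cancelˡ-≡ _ _ (2 ^ (a + b)) {{m^n≢0 2 (a + b)}} (begin
    2 ^ (a + b) * (Cb * X * (qa * qb))
      ≡⟨ cong (_* (Cb * X * (qa * qb))) (^-distribˡ-+-* 2 a b) ⟩
    2 ^ a * 2 ^ b * (Cb * X * (qa * qb))
      ≡⟨ regroup₁ (2 ^ a) (2 ^ b) Cb X qa qb ⟩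
    Cb * X * ((2 ^ a * qa) * (2 ^ b * qb))
      ≡⟨ cong₂ (λ u v → Cb * X * (u * v)) (sym a!≡) (sym b!≡) ⟩
    Cb * X * ((Ba * a !) * (Bb * b !))
      ≡⟨ regroup₂ Cb X Ba Bb (a !) (b !) ⟩
    Ba * Bb * (Cb * (X * (a ! * b !)))
      ≡⟨ cong (λ u → Ba * Bb * (Cb * u)) (binomial-factorials a b) ⟩
    Ba * Bb * (Cb * (a + b) !)
      ≡⟨ cong (Ba * Bb *_) [a+b]!≡ ⟩
    Ba * Bb * (2 ^ (a + b) * q)
      ≡⟨ regroup₃ Ba Bb (2 ^ (a + b)) q ⟩
    2 ^ (a + b) * (Ba * Bb * q)
      ≡⟨ cong (λ u → 2 ^ (a + b) * (u * q)) (sym (^-distribˡ-+-* 2 (B a) (B b))) ⟩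
    2 ^ (a + b) * (2 ^ (B a + B b) * q) ∎)
  where
  open ≡-Reasoning
  X  = (a + b) C a
  Ba = 2 ^ B a
  Bb = 2 ^ B b
  Cb = 2 ^ B (a + b)
  regroup₁ : ∀ x y c k u v → x * y * (c * k * (u * v)) ≡ c * k * ((x * u) * (y * v))
  regroup₁ = ℕ-Solver.solve-∀
  regroup₂ : ∀ c k s t fa fb → c * k * ((s * fa) * (t * fb)) ≡ s * t * (c * (k * (fa * fb)))
  regroup₂ = ℕ-Solver.solve-∀
  regroup₃ : ∀ s t x q → s * t * (x * q) ≡ x * (s * t * q)
  regroup₃ = ℕ-Solver.solve-∀

^-monoʳ-∣ : ∀ x {m n} → m ≤ n → x ^ m ∣ x ^ n
^-monoʳ-∣ x {m} {n} m≤n with m≤n⇒∃[o]m+o≡n m≤n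
... | o , m+o≡n = subst (λ e → x ^ m ∣ x ^ e) m+o≡n
                        (subst (x ^ m ∣_) (sym (^-distribˡ-+-* x m o)) (m∣m*n (x ^ o)))

binomial-not-divisible : ∀ a b {e} → B a + B b < e + B (a + b) → ¬ 2 ^ e ∣ (a + b) C a
binomial-not-divisible a b {e} digits< 2ᵉ∣C with binomial-2-adic a b
... | p , q , _ , odd-q , C≡ = odd-q (*-cancelˡ-∣ (2 ^ (B a + B b)) {{m^n≢0 2 (B a + B b)}} (begin
  2 ^ (B a + B b) * 2                ≡⟨ *-comm (2 ^ (B a + B b)) 2 ⟩
  2 ^ suc (B a + B b)                ∣⟨ ^-monoʳ-∣ 2 (subst (B a + B b <_) (+-comm e (B (a + b))) digits<) ⟩
  2 ^ (B (a + b) + e)                ≡⟨ ^-distribˡ-+-* 2 (B (a + b)) e ⟩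
  2 ^ B (a + b) * 2 ^ e              ∣⟨ *-monoʳ-∣ℕ (2 ^ B (a + b)) 2ᵉ∣C ⟩
  2 ^ B (a + b) * ((a + b) C a)      ∣⟨ m∣m*n p ⟩
  2 ^ B (a + b) * ((a + b) C a) * p  ≡⟨ C≡ ⟩
  2 ^ (B a + B b) * q                ∎))
  where open ∣-Reasoning

central-binomial-not-divisible : ∀ N → ¬ 2 ^ B (suc N) ∣ N C ⌊ N /2⌋
central-binomial-not-divisible N =
  subst (λ n → ¬ 2 ^ B (suc N) ∣ n C ⌊ N /2⌋) (⌊n/2⌋+⌈n/2⌉≡n N)
        (binomial-not-divisible ⌊ N /2⌋ ⌈ N /2⌉
          (subst (λ n → B ⌊ N /2⌋ + B ⌈ N /2⌉ < B (suc N) + B n) (sym (⌊n/2⌋+⌈n/2⌉≡n N))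
                 (≤-reflexive (B-halves N))))

pow2-∣-bound : ∀ {n k e x} → 2 ^ n ∣ 2 ^ k * x → ¬ 2 ^ e ∣ x → n < k + e
pow2-∣-bound {n} {k} {e} 2ⁿ∣ ¬2ᵉ∣x = ≰⇒> λ k+e≤n →
  ¬2ᵉ∣x (*-cancelˡ-∣ (2 ^ k) {{m^n≢0 2 k}}
    (∣-trans (subst (_∣ 2 ^ n) (^-distribˡ-+-* 2 k e) (^-monoʳ-∣ 2 k+e≤n)) 2ⁿ∣))

majority-circuit-divisible : ∀ {N k} (circ : Circuit (suc N) k) o → Computes circ o (MAJ (suc N)) →
                             2 ^ suc N ∣ 2 ^ suc (andCount circ) * (N C ⌊ N /2⌋)
majority-circuit-divisible {N} circ o computes =
  subst (2 ^ suc N ∣_) (trans (cong ℤ.∣_∣ (cong (+ (2 ^ andCount circ) ℤ.*_) bias≡)) absolute≡)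
        (∣⇒∣ᵤ (piecewiseAffine-granular (wires-piecewiseAffine circ) o (lookup-affine zero)))
  where
  bias≡ : bias (suc N) (λ x → lookup (wires circ x) o xor lookup x zero) ≡ + (N C ⌊ N /2⌋) ℤ.* + 2
  bias≡ = trans (sumCube-cong (suc N) (λ x → cong (λ b → sgn (b xor lookup x zero)) (computes x)))
                (bias-majority-xor-head N)
  absolute≡ : ℤ.∣ + (2 ^ andCount circ) ℤ.* (+ (N C ⌊ N /2⌋) ℤ.* + 2) ∣ ≡
              2 ^ suc (andCount circ) * (N C ⌊ N /2⌋)
  absolute≡ = begin
    ℤ.∣ + (2 ^ andCount circ) ℤ.* (+ (N C ⌊ N /2⌋) ℤ.* + 2) ∣
      ≡⟨ ℤ.abs-* (+ (2 ^ andCount circ)) _ ⟩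
    2 ^ andCount circ * ℤ.∣ + (N C ⌊ N /2⌋) ℤ.* + 2 ∣
      ≡⟨ cong (2 ^ andCount circ *_) (ℤ.abs-* (+ (N C ⌊ N /2⌋)) (+ 2)) ⟩
    2 ^ andCount circ * ((N C ⌊ N /2⌋) * 2)
      ≡⟨ regroup (2 ^ andCount circ) (N C ⌊ N /2⌋) ⟩
    2 * 2 ^ andCount circ * (N C ⌊ N /2⌋) ∎
    where
    open ≡-Reasoning
    regroup : ∀ t c → t * (c * 2) ≡ 2 * t * c
    regroup = ℕ-Solver.solve-∀

corollary11 : (n : ℕ) → 1 ≤ n → McLowerBound n (MAJ n) (n ∸ B n)
corollary11 zero    ()
corollary11 (suc N) _ circ o computes =
  m≤n+o⇒m∸n≤o (suc N) (B (suc N)) (subst (suc N ≤_) (+-comm (andCount circ) (B (suc N))) (≤-pred bound))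
  where
  bound : suc N < suc (andCount circ) + B (suc N)
  bound = pow2-∣-bound {k = suc (andCount circ)} {e = B (suc N)}
                       (majority-circuit-divisible circ o computes) (central-binomial-not-divisible N)
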